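{- Let $G$ be a graph, and consider the gp achievement game on $G$ in which the vertices played in order are $a_1,b_1,a_2,b_2,\ldots$ ($a_i$ played by A, $b_i$ by B). (i) If A has a strategy such that after the vertex $a_k$, for some $k\ge 1$, is played, the set $\mathrm{Pl}_G(a_1,b_1,\ldots,a_k)\cup\{a_1,b_1,\ldots,a_k\}$ is a general position set of $G$ and $|\mathrm{Pl}_G(a_1,b_1,\ldots,a_k)|$ is even, then A wins the gp achievement game on $G$. (ii) If B has a strategy such that after the vertex $b_k$, for some $k\ge 1$, is played, the set $\mathrm{Pl}_G(a_1,b_1,\ldots,b_k)\cup\{a_1,b_1,\ldots,b_k\}$ is a general position set of $G$ and $|\mathrm{Pl}_G(a_1,b_1,\ldots,b_k)|$ is even, then B wins the gp achievement game on $G$.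
   Context: All graphs are finite and simple. A general position set of a graph $G$ is a set $S\subseteq V(G)$ such that no three vertices of $S$ lie on a common shortest path of $G$. The gp achievement game on $G$: players A and B alternately select vertices of $G$, A first; a selection of a vertex is legal if it has not been selected before and the set of all vertices selected so far (including it) is a general position set of $G$. The game ends when no legal move exists, and the player who selected the last vertex wins; "a player wins the game" means that player has a winning strategy. If $x_1,\ldots,x_j$ are the vertices played so far, $\mathrm{Pl}_G(x_1,\ldots,x_j)$ is the set of playable vertices, i.e. vertices $y\notin\{x_1,\ldots,x_j\}$ such that $\{x_1,\ldots,x_j,y\}$ is a general position set of $G$. -}

module Defs where

open import Data.Nat using (ℕ; zero; suc; _≤_)
open import Data.Nat.Divisibility using (_∣_)
open import Data.Fin using (Fin)
open import Data.List using (List; []; _∷_; length)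
open import Data.List.Membership.Propositional using (_∈_; _∉_)
open import Data.List.Relation.Unary.Unique.Propositional using (Unique)
open import Data.Product using (Σ; ∃; _×_; _,_)
open import Data.Sum using (_⊎_)
open import Relation.Nullary using (¬_)
open import Relation.Binary.PropositionalEquality using (_≡_; _≢_)
open import Function.Bundles using (_⇔_)

record Graph (n : ℕ) : Set₁ where
  field
    Adj     : Fin n → Fin n → Set
    sym     : ∀ {u v} → Adj u v → Adj v u
    irrefl  : ∀ {u} → ¬ Adj u u

module _ {n : ℕ} (G : Graph n) where
  open Graph G

  data Walk : Fin n → Fin n → Set where
    here : ∀ {u} → Walk u u
    step : ∀ {u v w} → Adj u v → Walk v w → Walk u w

  walkLength : ∀ {u w} → Walk u w → ℕ
  walkLength here       = zero
  walkLength (step _ p) = suc (walkLength p)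

  data OnWalk (x : Fin n) : ∀ {u w} → Walk u w → Set where
    at    : ∀ {w} {p : Walk x w} → OnWalk x p
    later : ∀ {u v w} {a : Adj u v} {p : Walk v w} → OnWalk x p → OnWalk x (step a p)

  IsShortest : ∀ {u w} → Walk u w → Set
  IsShortest {u} {w} p = ∀ (q : Walk u w) → walkLength p ≤ walkLength q

  OnCommonShortestPath : Fin n → Fin n → Fin n → Set
  OnCommonShortestPath u v x =
    Σ (Fin n) λ s → Σ (Fin n) λ t → Σ (Walk s t) λ p →
      IsShortest p × OnWalk u p × OnWalk v p × OnWalk x p

  IsGP : (Fin n → Set) → Set
  IsGP S = ∀ u v x → S u → S v → S x → u ≢ v → v ≢ x → u ≢ x →
           ¬ OnCommonShortestPath u v x

  -- Positions of the game: list of vertices played so far, most recent first.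
  Position : Set
  Position = List (Fin n)

  Playable : Position → Fin n → Set
  Playable ps y = y ∉ ps × IsGP (λ z → z ∈ (y ∷ ps))

  PlUnion : Position → Fin n → Set
  PlUnion ps z = Playable ps z ⊎ z ∈ ps

  PlEven : Position → Set
  PlEven ps = ∃ λ (L : List (Fin n)) →
    Unique L × (∀ y → (y ∈ L) ⇔ Playable ps y) × (2 ∣ length L)

  GoodPos : Position → Set
  GoodPos ps = IsGP (PlUnion ps) × PlEven ps

  -- Outcomes: Win ps = the player to move at ps has a winning strategy;
  -- Lose ps = every legal move leads to a position where the opponent wins
  -- (in particular, no legal move: the previous player made the last move).
  data Win  : Position → Set
  data Lose : Position → Set
  data Win where
    win : ∀ {ps} y → Playable ps y → Lose (y ∷ ps) → Win ps
  data Lose where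
    lose : ∀ {ps} → (∀ y → Playable ps y → Win (y ∷ ps)) → Lose ps

  -- The player to move at ps has a strategy which guarantees that, after one
  -- of their own moves, the resulting position satisfies C.
  data CanForce (C : Position → Set) : Position → Set where
    now   : ∀ {ps} y → Playable ps y → C (y ∷ ps) → CanForce C ps
    later : ∀ {ps} y → Playable ps y →
            (∀ z → Playable (y ∷ ps) z → CanForce C (z ∷ y ∷ ps)) →
            CanForce C ps

  AWins : Set
  AWins = Win []

  BWins : Set
  BWins = Lose []

{-# OPTIONS --safe #-}
module Submission where

-- Once Pl(ps) ∪ ps is in general position, every set of vertices drawn from
-- Pl(ps) is again in general position with ps, so a playable vertex stays
-- playable until it is itself played. From such a position the game lasts
-- exactly |Pl(ps)| more moves whatever the players do; if that number is even,
-- the player who just moved also moves last.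

open import Defs
open import Data.Nat using (ℕ; zero; suc; _*_)
open import Data.Nat.Properties using (suc-injective)
open import Data.Nat.Divisibility using (divides)
open import Data.Fin using (_≟_)
open import Data.List using (List; []; _∷_; length; filter)
open import Data.List.Properties using (filter-all)
open import Data.List.Membership.Propositional using (_∈_)
open import Data.List.Membership.Propositional.Properties using (∈-filter⁺; ∈-filter⁻)
open import Data.List.Relation.Unary.Any using (here; there)
import Data.List.Relation.Unary.All as All
open import Data.List.Relation.Unary.AllPairs using (_∷_)
open import Data.List.Relation.Unary.Unique.Propositional using (Unique)
open import Data.List.Relation.Unary.Unique.Propositional.Properties using (filter⁺)
open import Data.Product using (∃; _×_; _,_; proj₁)
open import Data.Sum using (inj₁; inj₂)
open import Data.Empty using (⊥-elim)
open import Relation.Nullary using (¬_; yes; no; ¬?)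
open import Relation.Binary.Definitions using (DecidableEquality)
open import Relation.Binary.PropositionalEquality using (_≡_; _≢_; refl; trans; sym; cong; ≢-sym)
open import Function using (_∘_)
open import Function.Bundles using (_⇔_; mk⇔; Equivalence)

module FiniteSize {A : Set} (_≟ᴬ_ : DecidableEquality A) where

  HasSize : (A → Set) → ℕ → Set
  HasSize P m = ∃ λ (L : List A) → Unique L × (∀ y → (y ∈ L) ⇔ P y) × length L ≡ m

  remove : A → List A → List A
  remove y = filter (λ x → ¬? (x ≟ᴬ y))

  length-remove : ∀ {y} {L : List A} → Unique L → y ∈ L → length L ≡ suc (length (remove y L))
  length-remove {y} {x ∷ xs} (x∉xs ∷ uniq) y∈L with x ≟ᴬ y | y∈L
  ... | yes refl | here _    = sym (cong (suc ∘ length) (filter-all _ (All.map ≢-sym x∉xs)))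
  ... | yes refl | there y∈  = ⊥-elim (All.lookup x∉xs y∈ refl)
  ... | no x≢y   | here refl = ⊥-elim (x≢y refl)
  ... | no _     | there y∈  = cong suc (length-remove uniq y∈)

  HasSize-zero : ∀ {P : A → Set} {y} → HasSize P 0 → ¬ P y
  HasSize-zero ([] , _ , P⇔ , _) Py with () ← Equivalence.from (P⇔ _) Py

  HasSize-suc-inhabited : ∀ {P : A → Set} {m} → HasSize P (suc m) → ∃ P
  HasSize-suc-inhabited (x ∷ _ , _ , P⇔ , _) = x , Equivalence.to (P⇔ x) (here refl)

  HasSize-remove : ∀ {P Q : A → Set} {m y} → HasSize P (suc m) → P y →
                   (∀ z → Q z ⇔ (P z × z ≢ y)) → HasSize Q m
  HasSize-remove {Q = Q} {y = y} (L , uniq , P⇔ , |L|≡) Py Q⇔ =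
    remove y L , filter⁺ _ uniq , ∈⇔Q ,
    suc-injective (trans (sym (length-remove uniq (from (P⇔ y) Py))) |L|≡)
    where
    open Equivalence
    ∈⇔Q : ∀ z → (z ∈ remove y L) ⇔ Q z
    ∈⇔Q z = mk⇔
      (λ z∈ → let z∈L , z≢y = ∈-filter⁻ _ z∈ in from (Q⇔ z) (to (P⇔ z) z∈L , z≢y))
      (λ Qz → let Pz , z≢y = to (Q⇔ z) Qz in ∈-filter⁺ _ (from (P⇔ z) Pz) z≢y)

module _ {n : ℕ} (G : Graph n) where

  open FiniteSize (_≟_ {n})

  IsGP-⊆ : ∀ {S T} → IsGP G S → (∀ z → T z → S z) → IsGP G T
  IsGP-⊆ gpS T⊆S u v x Tu Tv Tx = gpS u v x (T⊆S u Tu) (T⊆S v Tv) (T⊆S x Tx)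

  Playable-∷⁻ : ∀ {ps y z} → Playable G (y ∷ ps) z → Playable G ps z × z ≢ y
  Playable-∷⁻ (z∉ , gp) =
    (z∉ ∘ there , IsGP-⊆ gp λ { _ (here refl) → here refl ; _ (there w∈) → there (there w∈) }) ,
    z∉ ∘ here

  module _ {ps y} (gpUnion : IsGP G (PlUnion G ps)) (Py : Playable G ps y) where

    Playable-∷⁺ : ∀ {z} → Playable G ps z → z ≢ y → Playable G (y ∷ ps) z
    Playable-∷⁺ Pz z≢y =
      (λ { (here z≡y) → z≢y z≡y ; (there z∈) → proj₁ Pz z∈ }) ,
      IsGP-⊆ gpUnion λ { _ (here refl) → inj₁ Pz ; _ (there (here refl)) → inj₁ Py ;
                         _ (there (there w∈)) → inj₂ w∈ }

    IsGP-PlUnion-∷ : IsGP G (PlUnion G (y ∷ ps))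
    IsGP-PlUnion-∷ = IsGP-⊆ gpUnion λ
      { _ (inj₁ Pz) → inj₁ (proj₁ (Playable-∷⁻ Pz))
      ; _ (inj₂ (here refl)) → inj₁ Py
      ; _ (inj₂ (there z∈)) → inj₂ z∈ }

  Settled : ℕ → Position G → Set
  Settled m ps = IsGP G (PlUnion G ps) × HasSize (Playable G ps) m

  Settled-∷ : ∀ {m ps y} → Settled (suc m) ps → Playable G ps y → Settled m (y ∷ ps)
  Settled-∷ (gp , size) Py =
    IsGP-PlUnion-∷ gp Py ,
    HasSize-remove size Py λ z → mk⇔ Playable-∷⁻ λ (Pz , z≢y) → Playable-∷⁺ gp Py Pz z≢y

  Settled-even⇒Lose : ∀ q {ps} → Settled (q * 2) ps → Lose G ps
  Settled-odd⇒Win : ∀ q {ps} → Settled (suc (q * 2)) ps → Win G ps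
  Settled-even⇒Lose zero    (_ , size) = lose λ _ Py → ⊥-elim (HasSize-zero size Py)
  Settled-even⇒Lose (suc q) settled    = lose λ _ Py → Settled-odd⇒Win q (Settled-∷ settled Py)
  Settled-odd⇒Win q settled@(_ , size) with x , Px ← HasSize-suc-inhabited size =
    win x Px (Settled-even⇒Lose q (Settled-∷ settled Px))

  GoodPos⇒Lose : ∀ {ps} → GoodPos G ps → Lose G ps
  GoodPos⇒Lose (gp , L , uniq , L⇔ , divides q |L|≡) =
    Settled-even⇒Lose q (gp , L , uniq , L⇔ , |L|≡)

  CanForce-GoodPos⇒Win : ∀ {ps} → CanForce G (GoodPos G) ps → Win G ps
  CanForce-GoodPos⇒Win (now y Py good) = win y Py (GoodPos⇒Lose good)
  CanForce-GoodPos⇒Win (later y Py f)  = win y Py (lose λ z Pz → CanForce-GoodPos⇒Win (f z Pz))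

theorem2p2 : ∀ {n : ℕ} (G : Graph n) →
    (CanForce G (GoodPos G) [] → AWins G) ×
    ((∀ a → Playable G [] a → CanForce G (GoodPos G) (a ∷ [])) → BWins G)
theorem2p2 G =
  CanForce-GoodPos⇒Win G ,
  λ forceB → lose λ a Pa → CanForce-GoodPos⇒Win G (forceB a Pa)
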